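{- For any finite connected graph $G$ with $n$ vertices and $2n-3$ edges, $wp(G)=2$.
   Context: A configuration of pebbles on a graph $G$ is a function $C:V(G)\to\mathbb{N}$; its size is $\sum_{v}C(v)$. A weight distribution $W$ on $G$ assigns to each edge $e$ a weight $w_e$ with $0\le w_e\le 1$; its total weight is $|W|=\sum_{e\in E(G)}w_e$, and $G_W$ denotes the resulting weighted graph. A pebbling step along an edge $uv$ of weight $w$ removes $k$ pebbles from $u$ (for some positive integer $k$ not exceeding the number of pebbles on $u$) and adds $\lfloor wk\rfloor$ pebbles to $v$. A target vertex $t$ can be reached from a configuration $C$ if some sequence of pebbling steps yields a configuration with at least one pebble on $t$. $G_W$ is $p$-solvable if every configuration of $p$ pebbles can reach every target vertex. The weighted pebbling number $wp(G)$ of the unweighted graph $G$ is the smallest positive integer $p$ for which there exists a weight distribution $W$ on $G$ with $|W|=|E(G)|/2$ such that $G_W$ is $p$-solvable.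
   Formalization: The edge weights $w_e$ of every weight distribution are rational. -}

module Defs where

open import Data.Nat as ℕ using (ℕ; zero; suc; _+_; _∸_)
open import Data.Integer as ℤ using (ℤ; +_)
open import Data.Rational as ℚ using (ℚ; 0ℚ; 1ℚ; floor)
open import Data.Fin using (Fin; toℕ; _≟_)
open import Data.Product using (_×_; _,_; proj₁; proj₂; Σ; ∃)
open import Function.Definitions using (Injective)
open import Relation.Binary.PropositionalEquality using (_≡_)
open import Relation.Nullary using (¬_; yes; no)
open import Relation.Binary.Construct.Closure.ReflexiveTransitive using (Star)

-- Edges are listed injectively as ordered pairs (u , v) with u < v,
-- so each unordered pair {u,v} (u ≠ v) appears at most once; |E(G)| = m.
record Graph (n m : ℕ) : Set where
  field
    edge     : Fin m → Fin n × Fin n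
    ordered  : ∀ e → toℕ (proj₁ (edge e)) ℕ.< toℕ (proj₂ (edge e))
    distinct : Injective _≡_ _≡_ edge
open Graph public

data Adj {n m : ℕ} (G : Graph n m) : Fin n → Fin n → Set where
  fwd : ∀ e → Adj G (proj₁ (edge G e)) (proj₂ (edge G e))
  bwd : ∀ e → Adj G (proj₂ (edge G e)) (proj₁ (edge G e))

Connected : {n m : ℕ} → Graph n m → Set
Connected G = ∀ u v → Star (Adj G) u v

Weights : ℕ → Set
Weights m = Fin m → ℚ

sumℚ : {m : ℕ} → (Fin m → ℚ) → ℚ
sumℚ {zero}  f = 0ℚ
sumℚ {suc m} f = f Data.Fin.zero ℚ.+ sumℚ (λ i → f (Data.Fin.suc i))

ValidHalf : (m : ℕ) → Weights m → Set
ValidHalf m W = (∀ e → (0ℚ ℚ.≤ W e) × (W e ℚ.≤ 1ℚ)) × (sumℚ W ≡ (+ m) ℚ./ 2)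

Config : ℕ → Set
Config n = Fin n → ℕ

size : {n : ℕ} → Config n → ℕ
size {zero}  C = 0
size {suc n} C = C Data.Fin.zero + size (λ i → C (Data.Fin.suc i))

-- ⌊w k⌋ for w ≥ 0 (the floor is then non-negative).
⌊_·_⌋ : ℚ → ℕ → ℕ
⌊ w · k ⌋ = ℤ.∣ floor (w ℚ.* ((+ k) ℚ./ 1)) ∣

move : {n : ℕ} → Config n → Fin n → Fin n → ℚ → ℕ → Config n
move C u v w k x with x ≟ u
... | yes _ = C u ∸ k
... | no _ with x ≟ v
...   | yes _ = C v + ⌊ w · k ⌋
...   | no _  = C x

data Step {n m : ℕ} (G : Graph n m) (W : Weights m) : Config n → Config n → Set where
  stepFwd : ∀ C e k → 1 ℕ.≤ k → k ℕ.≤ C (proj₁ (edge G e)) →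
            Step G W C (move C (proj₁ (edge G e)) (proj₂ (edge G e)) (W e) k)
  stepBwd : ∀ C e k → 1 ℕ.≤ k → k ℕ.≤ C (proj₂ (edge G e)) →
            Step G W C (move C (proj₂ (edge G e)) (proj₁ (edge G e)) (W e) k)

CanReach : {n m : ℕ} → Graph n m → Weights m → Config n → Fin n → Set
CanReach G W C t = ∃ λ D → Star (Step G W) C D × (1 ℕ.≤ D t)

Solvable : {n m : ℕ} → Graph n m → Weights m → ℕ → Set
Solvable G W p = ∀ C → size C ≡ p → ∀ t → CanReach G W C t

WpEquals : {n m : ℕ} → Graph n m → ℕ → Set
WpEquals {n} {m} G p =
  (1 ℕ.≤ p) ×
  (Σ (Weights m) λ W → ValidHalf m W × Solvable G W p) ×
  (∀ q → 1 ℕ.≤ q → q ℕ.< p → ∀ W → ValidHalf m W → ¬ Solvable G W q)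

{-# OPTIONS --safe #-}
-- One pebble does not suffice: moving a lone pebble along an edge of weight w < 1 destroys
-- it (⌊w⌋ = 0), so if one pebble can reach every vertex then the edges of weight 1 connect G;
-- there are at least n − 1 of them, more than the total weight m/2 = n − 3/2.
--
-- Two pebbles suffice: choose an edge e₀ = ac and a forest T of n − 2 further edges in which
-- every vertex is joined to a or to c. Weight T by 1, e₀ by ½ and all other edges by 0, for a
-- total of n − 3/2. Pebbles travel along T without loss, so a pebble on the side of the target
-- t walks to t; otherwise both pebbles are gathered at the root on the other side, and moving
-- them across e₀ leaves one pebble at the root on t's side.

module Submission where

open import Defs
open import Data.Nat using (ℕ; _+_; _*_)
open import Relation.Binary.PropositionalEquality using (_≡_)

open import Data.Bool using (if_then_else_)
open import Data.Fin using (Fin; zero; suc; toℕ; _≟_)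
import Data.Fin.Properties as Fin
open import Data.Fin.Subset
  using (Subset; inside; outside; _∈_; _∉_; _⊆_; _∪_; ⁅_⁆; ∁; ⊥; ⊤; ∣_∣)
open import Data.Fin.Subset.Properties
  using ( _∈?_; nonempty?; drop-not-there; ∉⊥; ⊥⊆; ∈⊤; ⊆⊤; ⊆-antisym; ∣p∣≤n; ∣⊥∣≡0; ∣⊤∣≡n
        ; ∣p∣≡n⇒p≡⊤; p⊆q⇒∣p∣≤∣q∣; x∈⁅x⁆; x∈⁅y⁆⇒x≡y; x≢y⇒x∉⁅y⁆; ∣⁅x⁆∣≡1; ∪-identityˡ; x∈p∪q⁺; x∈p∪q⁻
        ; x∈∁p⇒x∉p; x∉∁p⇒x∈p)
open import Data.Integer as ℤ using (-[1+_])
import Data.Integer.Properties as ℤ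
open import Data.Integer.DivMod using (div-pos-is-/ℕ)
open import Data.Integer.Tactic.RingSolver using (solve-∀)
import Data.Nat as ℕ
open import Data.Nat using (_∸_; _≤_; _<_; z≤n; s≤s)
import Data.Nat.Properties as ℕ
import Data.Nat.DivMod as ℕ
open import Algebra.Properties.CommutativeSemigroup ℕ.+-commutativeSemigroup using (xy∙z≈xz∙y)
open import Data.Nat.Coprimality using (Coprime; gcd≡1⇒coprime)
open import Data.Nat.GCD using (gcd-zeroʳ)
open import Data.Product as Product using (_×_; _,_; proj₁; proj₂; Σ; ∃-syntax)
open import Data.Rational as ℚ using (ℚ; mkℚ; 0ℚ; 1ℚ; ½; floor; toℚᵘ)
import Data.Rational.Properties as ℚ
open import Data.Rational.Unnormalised as ℚᵘ using (mkℚᵘ; *≡*; *≤*)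
import Data.Rational.Unnormalised.Properties as ℚᵘ
open import Data.Sum using (_⊎_; inj₁; inj₂)
import Data.Sum as Sum
open import Data.Vec using ([]; _∷_; here; there; lookup; tabulate)
open import Data.Vec.Properties using ([]=⇒lookup; lookup⇒[]=; lookup∘tabulate)
open import Function using (_∘_)
open import Relation.Binary.Construct.Closure.ReflexiveTransitive
  using (Star; ε; _◅_; _◅◅_; reverse)
import Relation.Binary.Construct.Closure.ReflexiveTransitive as Star
open import Relation.Binary.PropositionalEquality
  using (refl; sym; trans; cong; cong₂; subst; subst₂; _≢_; module ≡-Reasoning)
open import Relation.Binary.Definitions using (tri<; tri≈; tri>)
open import Relation.Nullary using (¬_; Dec; yes; no; does; contradiction)
open import Relation.Nullary.Decidable using (dec-true; dec-false)

x∉p⇒∣⁅x⁆∪p∣≡1+∣p∣ : ∀ {n} (x : Fin n) (p : Subset n) → x ∉ p → ∣ ⁅ x ⁆ ∪ p ∣ ≡ ℕ.suc ∣ p ∣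
x∉p⇒∣⁅x⁆∪p∣≡1+∣p∣ zero    (inside  ∷ p) x∉p = contradiction here x∉p
x∉p⇒∣⁅x⁆∪p∣≡1+∣p∣ zero    (outside ∷ p) _   = cong (ℕ.suc ∘ ∣_∣) (∪-identityˡ p)
x∉p⇒∣⁅x⁆∪p∣≡1+∣p∣ (suc x) (inside  ∷ p) x∉p = cong ℕ.suc (x∉p⇒∣⁅x⁆∪p∣≡1+∣p∣ x p (drop-not-there x∉p))
x∉p⇒∣⁅x⁆∪p∣≡1+∣p∣ (suc x) (outside ∷ p) x∉p = x∉p⇒∣⁅x⁆∪p∣≡1+∣p∣ x p (drop-not-there x∉p)

∀x∈p⇒∣p∣≡n : ∀ {n} {p : Subset n} → (∀ x → x ∈ p) → ∣ p ∣ ≡ n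
∀x∈p⇒∣p∣≡n {n} all = trans (cong ∣_∣ (⊆-antisym ⊆⊤ λ {x} _ → all x)) (∣⊤∣≡n n)

-- Rational arithmetic

ι : ℕ → ℚ
ι k = ℤ.+ k ℚ./ 1

toℚᵘ-ι : ∀ k → toℚᵘ (ι k) ℚᵘ.≃ mkℚᵘ (ℤ.+ k) 0
toℚᵘ-ι k = ℚ.toℚᵘ-fromℚᵘ (mkℚᵘ (ℤ.+ k) 0)

ι-suc : ∀ k → ι (ℕ.suc k) ≡ 1ℚ ℚ.+ ι k
ι-suc k = ℚ.toℚᵘ-injective (begin-equality
  toℚᵘ (ι (ℕ.suc k))         ≃⟨ toℚᵘ-ι (ℕ.suc k) ⟩
  mkℚᵘ (ℤ.+ ℕ.suc k) 0         ≃⟨ *≡* (numerators (ℤ.+ k)) ⟩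
  toℚᵘ 1ℚ ℚᵘ.+ mkℚᵘ (ℤ.+ k) 0  ≃⟨ ℚᵘ.+-congʳ (toℚᵘ 1ℚ) (toℚᵘ-ι k) ⟨
  toℚᵘ 1ℚ ℚᵘ.+ toℚᵘ (ι k)    ≃⟨ ℚ.toℚᵘ-homo-+ 1ℚ (ι k) ⟨
  toℚᵘ (1ℚ ℚ.+ ι k)          ∎)
  where
  open ℚᵘ.≤-Reasoning
  numerators : ∀ i → (ℤ.+ 1 ℤ.+ i) ℤ.* ℤ.+ 1 ≡ (ℤ.+ 1 ℤ.* ℤ.+ 1 ℤ.+ i ℤ.* ℤ.+ 1) ℤ.* ℤ.+ 1
  numerators = solve-∀

½+ιt≡[1+2t]/2 : ∀ t → ½ ℚ.+ ι t ≡ ℤ.+ ℕ.suc (2 * t) ℚ./ 2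
½+ιt≡[1+2t]/2 t = ℚ.toℚᵘ-injective (begin-equality
  toℚᵘ (½ ℚ.+ ι t)                ≃⟨ ℚ.toℚᵘ-homo-+ ½ (ι t) ⟩
  toℚᵘ ½ ℚᵘ.+ toℚᵘ (ι t)          ≃⟨ ℚᵘ.+-congʳ (toℚᵘ ½) (toℚᵘ-ι t) ⟩
  mkℚᵘ (ℤ.+ 1) 1 ℚᵘ.+ mkℚᵘ (ℤ.+ t) 0  ≃⟨ *≡* (trans (numerators (ℤ.+ t)) (cong (λ i → (ℤ.+ 1 ℤ.+ i) ℤ.* ℤ.+ 2) 2t≡2*t)) ⟩
  mkℚᵘ (ℤ.+ ℕ.suc (2 * t)) 1          ≃⟨ ℚ.toℚᵘ-fromℚᵘ _ ⟨
  toℚᵘ (ℤ.+ ℕ.suc (2 * t) ℚ./ 2)      ∎)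
  where
  open ℚᵘ.≤-Reasoning
  2t≡2*t : ℤ.+ 2 ℤ.* ℤ.+ t ≡ ℤ.+ (2 * t)
  2t≡2*t = sym (ℤ.pos-* 2 t)
  numerators : ∀ i → (ℤ.+ 1 ℤ.* ℤ.+ 1 ℤ.+ i ℤ.* ℤ.+ 2) ℤ.* ℤ.+ 2 ≡ (ℤ.+ 1 ℤ.+ ℤ.+ 2 ℤ.* i) ℤ.* ℤ.+ 2
  numerators = solve-∀

ιc≤m/2⇒2c≤m : ∀ c m → ι c ℚ.≤ ℤ.+ m ℚ./ 2 → 2 * c ≤ m
ιc≤m/2⇒2c≤m c m c≤m/2
  with ℚᵘ.≤-respʳ-≃ (ℚ.toℚᵘ-fromℚᵘ (mkℚᵘ (ℤ.+ m) 1)) (ℚᵘ.≤-respˡ-≃ (toℚᵘ-ι c) (ℚ.toℚᵘ-mono-≤ c≤m/2))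
... | *≤* c*2≤m*1 = subst₂ _≤_ (ℕ.*-comm c 2) (ℕ.*-identityʳ m)
  (ℤ.drop‿+≤+ (subst₂ ℤ._≤_ (sym (ℤ.pos-* c 2)) (sym (ℤ.pos-* m 1)) c*2≤m*1))

∣floor[a/d]∣≡a/d : ∀ a d .(c : Coprime a (ℕ.suc d)) → ℤ.∣ floor (mkℚ (ℤ.+ a) d c) ∣ ≡ a ℕ./ ℕ.suc d
∣floor[a/d]∣≡a/d a d c = cong ℤ.∣_∣ (div-pos-is-/ℕ (ℤ.+ a) (ℕ.suc d))

⌊1·k⌋≡k : ∀ k → ⌊ 1ℚ · k ⌋ ≡ k
⌊1·k⌋≡k k = begin
  ℤ.∣ floor (1ℚ ℚ.* ι k) ∣          ≡⟨ cong (ℤ.∣_∣ ∘ floor) (ℚ.*-identityˡ (ι k)) ⟩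
  ℤ.∣ floor (ι k) ∣                 ≡⟨ cong (ℤ.∣_∣ ∘ floor) (ℚ.fromℚᵘ-toℚᵘ (mkℚ (ℤ.+ k) 0 k⊥1)) ⟩
  ℤ.∣ floor (mkℚ (ℤ.+ k) 0 k⊥1) ∣     ≡⟨ ∣floor[a/d]∣≡a/d k 0 k⊥1 ⟩
  k ℕ./ 1                          ≡⟨ ℕ.n/1≡n k ⟩
  k                                ∎
  where
  open ≡-Reasoning
  k⊥1 : Coprime k 1
  k⊥1 = gcd≡1⇒coprime (gcd-zeroʳ k)

⌊w·1⌋≡0 : ∀ {w} → 0ℚ ℚ.≤ w → w ℚ.< 1ℚ → ⌊ w · 1 ⌋ ≡ 0
⌊w·1⌋≡0 {w} 0≤w w<1 rewrite ℚ.*-identityʳ w = floor≡0 w 0≤w w<1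
  where
  floor≡0 : ∀ w → 0ℚ ℚ.≤ w → w ℚ.< 1ℚ → ℤ.∣ floor w ∣ ≡ 0
  floor≡0 (mkℚ -[1+ a ] d c) (ℚ.*≤* ()) _
  floor≡0 (mkℚ (ℤ.+ a) d c) _ (ℚ.*<* a*1<1*d) = trans (∣floor[a/d]∣≡a/d a d c) (ℕ.m<n⇒m/n≡0 (ℤ.drop‿+<+ a<d))
    where
    a<d : ℤ.+ a ℤ.< ℤ.+ ℕ.suc d
    a<d = subst₂ ℤ._<_ (ℤ.*-identityʳ (ℤ.+ a)) (ℤ.*-identityˡ (ℤ.+ ℕ.suc d)) a*1<1*d

indicator : ∀ {m} → Subset m → Fin m → ℚ
indicator p e = if lookup p e then 1ℚ else 0ℚ

sumℚ-indicator : ∀ {m} (p : Subset m) → sumℚ (indicator p) ≡ ι ∣ p ∣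
sumℚ-indicator []            = refl
sumℚ-indicator (inside  ∷ p) = trans (cong (1ℚ ℚ.+_) (sumℚ-indicator p)) (sym (ι-suc ∣ p ∣))
sumℚ-indicator (outside ∷ p) = trans (ℚ.+-identityˡ _) (sumℚ-indicator p)

indicator-bounds : ∀ {m} (p : Subset m) e → (0ℚ ℚ.≤ indicator p e) × (indicator p e ℚ.≤ 1ℚ)
indicator-bounds p e with lookup p e
... | inside  = ℚ.*≤* (ℤ.+≤+ z≤n) , ℚ.≤-refl
... | outside = ℚ.≤-refl , ℚ.*≤* (ℤ.+≤+ z≤n)

sumℚ-mono-≤ : ∀ {m} {f g : Fin m → ℚ} → (∀ e → f e ℚ.≤ g e) → sumℚ f ℚ.≤ sumℚ g
sumℚ-mono-≤ {ℕ.zero}  f≤g = ℚ.≤-refl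
sumℚ-mono-≤ {ℕ.suc m} f≤g = ℚ.+-mono-≤ (f≤g zero) (sumℚ-mono-≤ (f≤g ∘ suc))

-- Spanning forests

module _ {n m : ℕ} (G : Graph n m) where

  Joins : Fin m → Fin n → Fin n → Set
  Joins e x y = edge G e ≡ (x , y) ⊎ edge G e ≡ (y , x)

  joins-≢ : ∀ {e x y} → Joins e x y → x ≢ y
  joins-≢ {e} (inj₁ e≡xx) refl = ℕ.<-irrefl refl (subst (λ (u , v) → toℕ u < toℕ v) e≡xx (ordered G e))
  joins-≢ {e} (inj₂ e≡xx) refl = ℕ.<-irrefl refl (subst (λ (u , v) → toℕ u < toℕ v) e≡xx (ordered G e))

  Within : Subset n → Fin m → Set
  Within S e = proj₁ (edge G e) ∈ S × proj₂ (edge G e) ∈ S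

  joins-within⁺ : ∀ {e x y S} → Joins e x y → x ∈ S → y ∈ S → Within S e
  joins-within⁺ {S = S} (inj₁ eq) x∈S y∈S = subst (λ (u , v) → u ∈ S × v ∈ S) (sym eq) (x∈S , y∈S)
  joins-within⁺ {S = S} (inj₂ eq) x∈S y∈S = subst (λ (u , v) → u ∈ S × v ∈ S) (sym eq) (y∈S , x∈S)

  joins-within⁻ : ∀ {e x y S} → Joins e x y → Within S e → y ∈ S
  joins-within⁻ {S = S} (inj₁ eq) = proj₂ ∘ subst (λ (u , v) → u ∈ S × v ∈ S) eq
  joins-within⁻ {S = S} (inj₂ eq) = proj₁ ∘ subst (λ (u , v) → u ∈ S × v ∈ S) eq

  Link : Subset m → Fin n → Fin n → Set
  Link F x y = ∃[ e ] e ∈ F × Joins e x y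

  Link-sym : ∀ {F x y} → Link F x y → Link F y x
  Link-sym (e , e∈F , j) = e , e∈F , Sum.swap j

  Link-mono : ∀ {F F′} → F ⊆ F′ → ∀ {x y} → Link F x y → Link F′ x y
  Link-mono F⊆F′ (e , e∈F , j) = e , F⊆F′ e∈F , j

  ReachableFrom : Subset m → Subset n → Fin n → Set
  ReachableFrom F S v = ∃[ s ] s ∈ S × Star (Link F) s v

  ReachableFrom-mono : ∀ {F F′ S v} → F ⊆ F′ → ReachableFrom F S v → ReachableFrom F′ S v
  ReachableFrom-mono F⊆F′ (s , s∈S , walk) = s , s∈S , Star.map (Link-mono F⊆F′) walk

  crossing-link : ∀ {P S s v} → s ∈ S → v ∉ S → Star (Link P) s v →
                  ∃[ x ] ∃[ y ] x ∈ S × y ∉ S × Link P x y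
  crossing-link s∈S v∉S ε = contradiction s∈S v∉S
  crossing-link {S = S} s∈S v∉S (_◅_ {j = z} link walk) with z ∈? S
  ... | yes z∈S = crossing-link z∈S v∉S walk
  ... | no  z∉S = _ , z , s∈S , z∉S , link

  -- A state of Prim's algorithm growing, inside P, a forest rooted at the vertices of S₀.
  record PartialForest (P : Subset m) (S₀ : Subset n) : Set where
    field
      covered      : Subset n
      edges        : Subset m
      edges⊆P      : edges ⊆ P
      S₀⊆covered   : S₀ ⊆ covered
      edges-within : ∀ {e} → e ∈ edges → Within covered e
      counted      : ∣ edges ∣ + ∣ S₀ ∣ ≡ ∣ covered ∣
      spans        : ∀ {x} → x ∈ covered → ReachableFrom edges S₀ x

  module _ {P : Subset m} {S₀ : Subset n} where
    open PartialForest

    extend : (T : PartialForest P S₀) → ∀ {v} → v ∉ covered T → ReachableFrom P S₀ v →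
             Σ (PartialForest P S₀) λ T′ → ∣ covered T′ ∣ ≡ ℕ.suc ∣ covered T ∣
    extend T v∉T (s , s∈S₀ , walk) with crossing-link (S₀⊆covered T s∈S₀) v∉T walk
    ... | x , y , x∈T , y∉T , e , e∈P , j = T′ , x∉p⇒∣⁅x⁆∪p∣≡1+∣p∣ y (covered T) y∉T
      where
      e∉T : e ∉ edges T
      e∉T e∈T = y∉T (joins-within⁻ j (edges-within T e∈T))

      old-vertex : ∀ {u} → u ∈ covered T → u ∈ ⁅ y ⁆ ∪ covered T
      old-vertex = x∈p∪q⁺ ∘ inj₂

      old-edge : edges T ⊆ ⁅ e ⁆ ∪ edges T
      old-edge = x∈p∪q⁺ ∘ inj₂

      e∈T′ : e ∈ ⁅ e ⁆ ∪ edges T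
      e∈T′ = x∈p∪q⁺ (inj₁ (x∈⁅x⁆ e))

      T′ : PartialForest P S₀
      T′ .covered = ⁅ y ⁆ ∪ covered T
      T′ .edges   = ⁅ e ⁆ ∪ edges T
      T′ .edges⊆P {f} f∈T′ with x∈p∪q⁻ ⁅ e ⁆ (edges T) f∈T′
      ... | inj₁ f∈⁅e⁆ = subst (_∈ P) (sym (x∈⁅y⁆⇒x≡y e f∈⁅e⁆)) e∈P
      ... | inj₂ f∈T   = edges⊆P T f∈T
      T′ .S₀⊆covered = old-vertex ∘ S₀⊆covered T
      T′ .edges-within {f} f∈T′ with x∈p∪q⁻ ⁅ e ⁆ (edges T) f∈T′
      ... | inj₁ f∈⁅e⁆ rewrite x∈⁅y⁆⇒x≡y e f∈⁅e⁆ = joins-within⁺ j (old-vertex x∈T) (x∈p∪q⁺ (inj₁ (x∈⁅x⁆ y)))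
      ... | inj₂ f∈T   = Product.map old-vertex old-vertex (edges-within T f∈T)
      T′ .counted = begin
        (∣ ⁅ e ⁆ ∪ edges T ∣) + ∣ S₀ ∣ ≡⟨ cong (_+ ∣ S₀ ∣) (x∉p⇒∣⁅x⁆∪p∣≡1+∣p∣ e (edges T) e∉T) ⟩
        ℕ.suc ((∣ edges T ∣) + ∣ S₀ ∣) ≡⟨ cong ℕ.suc (counted T) ⟩
        ℕ.suc ∣ covered T ∣           ≡⟨ x∉p⇒∣⁅x⁆∪p∣≡1+∣p∣ y (covered T) y∉T ⟨
        ∣ ⁅ y ⁆ ∪ covered T ∣         ∎
        where open ≡-Reasoning
      T′ .spans {u} u∈T′ with x∈p∪q⁻ ⁅ y ⁆ (covered T) u∈T′
      ... | inj₂ u∈T   = ReachableFrom-mono old-edge (spans T u∈T)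
      ... | inj₁ u∈⁅y⁆ rewrite x∈⁅y⁆⇒x≡y y u∈⁅y⁆ with ReachableFrom-mono old-edge (spans T x∈T)
      ...   | r , r∈S₀ , walk = r , r∈S₀ , walk ◅◅ ((e , e∈T′ , j) ◅ ε)

    grow : ∀ k (T : PartialForest P S₀) → n ≤ k + ∣ covered T ∣ → (∀ v → ReachableFrom P S₀ v) →
           Σ (PartialForest P S₀) λ T′ → ∀ v → v ∈ covered T′
    grow k T n≤k+∣T∣ reach with nonempty? (∁ (covered T))
    ... | no  ¬missing   = T , λ v → x∉∁p⇒x∈p (λ v∈∁T → ¬missing (v , v∈∁T))
    grow ℕ.zero T n≤∣T∣ reach | yes (v , v∈∁T) =
      contradiction (subst (v ∈_) (sym (∣p∣≡n⇒p≡⊤ (ℕ.≤-antisym (∣p∣≤n (covered T)) n≤∣T∣))) ∈⊤) (x∈∁p⇒x∉p v∈∁T)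
    grow (ℕ.suc k) T n≤1+k+∣T∣ reach | yes (v , v∈∁T) with extend T (x∈∁p⇒x∉p v∈∁T) (reach v)
    ... | T′ , ∣T′∣≡1+∣T∣ =
      grow k T′ (subst (n ≤_) (trans (sym (ℕ.+-suc k _)) (cong (λ c → k + c) (sym ∣T′∣≡1+∣T∣))) n≤1+k+∣T∣) reach

  seed : ∀ P S₀ → PartialForest P S₀
  seed P S₀ = record
    { covered = S₀ ; edges = ⊥ ; edges⊆P = ⊥⊆ ; S₀⊆covered = λ s∈S₀ → s∈S₀
    ; edges-within = λ e∈⊥ → contradiction e∈⊥ ∉⊥ ; counted = cong (_+ ∣ S₀ ∣) (∣⊥∣≡0 m)
    ; spans = λ s∈S₀ → _ , s∈S₀ , ε }

  spanningForest : (P : Subset m) (S₀ : Subset n) → (∀ v → ReachableFrom P S₀ v) →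
                   ∃[ F ] F ⊆ P × ∣ F ∣ + ∣ S₀ ∣ ≡ n × (∀ v → ReachableFrom F S₀ v)
  spanningForest P S₀ reach with grow n (seed P S₀) (ℕ.m≤m+n n _) reach
  ... | T , all-covered = edges , edges⊆P , trans counted (∀x∈p⇒∣p∣≡n all-covered) , spans ∘ all-covered
    where open PartialForest T

-- Pebble configurations

module _ {n : ℕ} where

  δ : Fin n → ℕ → Config n
  δ x k v = if does (v ≟ x) then k else 0

  δ-self : ∀ x k → δ x k x ≡ k
  δ-self x k = cong (if_then k else 0) (dec-true (x ≟ x) refl)

  δ-other : ∀ {x v} k → v ≢ x → δ x k v ≡ 0
  δ-other {x} {v} k v≢x = cong (if_then k else 0) (dec-false (v ≟ x) v≢x)

  δ-≤ : ∀ x k v → δ x k v ≤ k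
  δ-≤ x k v with v ≟ x
  ... | yes _ = ℕ.≤-refl
  ... | no  _ = ℕ.z≤n

  δ-support : ∀ {x k v} → 1 ≤ δ x k v → v ≡ x
  δ-support {x} {k} {v} 1≤δ with v ≟ x
  ... | yes v≡x = v≡x

  move-source : ∀ (C : Config n) u v w k → move C u v w k u ≡ C u ∸ k
  move-source C u v w k with u ≟ u
  ... | yes _   = refl
  ... | no  u≢u = contradiction refl u≢u

  move-target : ∀ (C : Config n) u v w k → v ≢ u → move C u v w k v ≡ C v + ⌊ w · k ⌋
  move-target C u v w k v≢u with v ≟ u
  ... | yes v≡u = contradiction v≡u v≢u
  ... | no  _ with v ≟ v
  ...   | yes _   = refl
  ...   | no  v≢v = contradiction refl v≢v

  move-other : ∀ (C : Config n) u v w k x → x ≢ u → x ≢ v → move C u v w k x ≡ C x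
  move-other C u v w k x x≢u x≢v with x ≟ u
  ... | yes x≡u = contradiction x≡u x≢u
  ... | no  _ with x ≟ v
  ...   | yes x≡v = contradiction x≡v x≢v
  ...   | no  _   = refl

  move-≤ : ∀ (C : Config n) {u v} w k → v ≢ u → ⌊ w · k ⌋ ≡ 0 → ∀ x → move C u v w k x ≤ C x
  move-≤ C {u} {v} w k v≢u ⌊w·k⌋≡0 x = by-cases (x ≟ u) (x ≟ v)
    where
    by-cases : Dec (x ≡ u) → Dec (x ≡ v) → move C u v w k x ≤ C x
    by-cases (yes refl) _ = ℕ.≤-trans (ℕ.≤-reflexive (move-source C x v w k)) (ℕ.m∸n≤m (C x) k)
    by-cases (no x≢u) (yes refl) =
      ℕ.≤-reflexive (trans (move-target C u x w k v≢u) (trans (cong (C x +_) ⌊w·k⌋≡0) (ℕ.+-identityʳ (C x))))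
    by-cases (no x≢u) (no x≢v) = ℕ.≤-reflexive (move-other C u v w k x x≢u x≢v)

  -- D is C with k pebbles moved from x to y, stated additively because ∸ truncates.
  Transfer : ℕ → Fin n → Fin n → Config n → Config n → Set
  Transfer k x y C D = ∀ v → D v + δ x k v ≡ C v + δ y k v

  transfer-refl : ∀ {k x C} → Transfer k x x C C
  transfer-refl v = refl

  transfer-trans : ∀ {k x y z C D E} → Transfer k x y C D → Transfer k y z D E → Transfer k x z C E
  transfer-trans {k} {x} {y} {z} {C} {D} {E} C→D D→E v = ℕ.+-cancelʳ-≡ (δ y k v) _ _ (begin
    E v + δ x k v + δ y k v  ≡⟨ xy∙z≈xz∙y (E v) _ _ ⟩
    E v + δ y k v + δ x k v  ≡⟨ cong (_+ δ x k v) (D→E v) ⟩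
    D v + δ z k v + δ x k v  ≡⟨ xy∙z≈xz∙y (D v) _ _ ⟩
    D v + δ x k v + δ z k v  ≡⟨ cong (_+ δ z k v) (C→D v) ⟩
    C v + δ y k v + δ z k v  ≡⟨ xy∙z≈xz∙y (C v) _ _ ⟩
    C v + δ z k v + δ y k v  ∎)
    where open ≡-Reasoning

  transfer-target : ∀ {k x y C D} → k ≤ C x → Transfer k x y C D → k ≤ D y
  transfer-target {k} {x} {y} {C} {D} k≤Cx C→D with y ≟ x
  ... | yes refl = subst (k ≤_) (sym (ℕ.+-cancelʳ-≡ k (D y) (C y) Dy+k≡Cy+k)) k≤Cx
    where
    Dy+k≡Cy+k : D y + k ≡ C y + k
    Dy+k≡Cy+k = subst₂ (λ a b → D y + a ≡ C y + b) (δ-self y k) (δ-self y k) (C→D y)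
  ... | no  y≢x = subst (k ≤_) (sym Dy≡Cy+k) (ℕ.m≤n+m k (C y))
    where
    Dy≡Cy+k : D y ≡ C y + k
    Dy≡Cy+k = trans (sym (ℕ.+-identityʳ (D y)))
                (subst₂ (λ a b → D y + a ≡ C y + b) (δ-other k y≢x) (δ-self y k) (C→D y))

  transfer-gain : ∀ {k x y C D} → x ≢ y → Transfer k x y C D → D y ≡ C y + k
  transfer-gain {k} {x} {y} {C} {D} x≢y C→D = trans (sym (ℕ.+-identityʳ (D y)))
    (subst₂ (λ a b → D y + a ≡ C y + b) (δ-other k (x≢y ∘ sym)) (δ-self y k) (C→D y))

  transfer-move : ∀ (C : Config n) {u v} w k → v ≢ u → ⌊ w · k ⌋ ≡ k → k ≤ C u →
                  Transfer k u v C (move C u v w k)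
  transfer-move C {u} {v} w k v≢u ⌊w·k⌋≡k k≤Cu x = by-cases (x ≟ u) (x ≟ v)
    where
    open ≡-Reasoning
    by-cases : Dec (x ≡ u) → Dec (x ≡ v) → move C u v w k x + δ u k x ≡ C x + δ v k x
    by-cases (yes refl) _ = begin
      move C x v w k x + δ x k x  ≡⟨ cong₂ _+_ (move-source C x v w k) (δ-self x k) ⟩
      C x ∸ k + k                 ≡⟨ ℕ.m∸n+n≡m k≤Cu ⟩
      C x                         ≡⟨ ℕ.+-identityʳ (C x) ⟨
      C x + 0                     ≡⟨ cong (C x +_) (δ-other k (v≢u ∘ sym)) ⟨
      C x + δ v k x               ∎
    by-cases (no x≢u) (yes refl) = begin
      move C u x w k x + δ u k x  ≡⟨ cong₂ _+_ (move-target C u x w k v≢u) (δ-other k x≢u) ⟩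
      C x + ⌊ w · k ⌋ + 0          ≡⟨ ℕ.+-identityʳ _ ⟩
      C x + ⌊ w · k ⌋              ≡⟨ cong (C x +_) (trans ⌊w·k⌋≡k (sym (δ-self x k))) ⟩
      C x + δ x k x               ∎
    by-cases (no x≢u) (no x≢v) =
      cong₂ _+_ (move-other C u v w k x x≢u x≢v) (trans (δ-other k x≢u) (sym (δ-other k x≢v)))

size-0 : ∀ {n} → size (λ (_ : Fin n) → 0) ≡ 0
size-0 {ℕ.zero}  = refl
size-0 {ℕ.suc n} = size-0 {n}

size-δ : ∀ {n} (x : Fin n) k → size (δ x k) ≡ k
size-δ {ℕ.suc n} zero    k = trans (cong (k +_) (size-0 {n})) (ℕ.+-identityʳ k)
size-δ {ℕ.suc n} (suc x) k = size-δ x k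

pebble-at : ∀ {n} (C : Config n) → 1 ≤ size C → ∃[ x ] 1 ≤ C x
pebble-at {ℕ.suc n} C 1≤size with C zero in C₀≡
... | ℕ.suc _ = zero , subst (1 ≤_) (sym C₀≡) (s≤s z≤n)
... | ℕ.zero with pebble-at (C ∘ suc) 1≤size
...   | x , 1≤Cx = suc x , 1≤Cx

two-pebbles : ∀ {n} (C : Config n) → 2 ≤ size C →
              (∃[ x ] 2 ≤ C x) ⊎ (∃[ x ] ∃[ y ] x ≢ y × 1 ≤ C x × 1 ≤ C y)
two-pebbles {ℕ.suc n} C 2≤size with C zero in C₀≡
... | ℕ.suc (ℕ.suc _) = inj₁ (zero , subst (2 ≤_) (sym C₀≡) (s≤s (s≤s z≤n)))
... | ℕ.suc ℕ.zero with pebble-at (C ∘ suc) (ℕ.≤-pred 2≤size)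
...   | y , 1≤Cy = inj₂ (zero , suc y , (λ ()) , subst (1 ≤_) (sym C₀≡) (s≤s z≤n) , 1≤Cy)
two-pebbles {ℕ.suc n} C 2≤size | ℕ.zero with two-pebbles (C ∘ suc) 2≤size
... | inj₁ (x , 2≤Cx) = inj₁ (suc x , 2≤Cx)
... | inj₂ (x , y , x≢y , 1≤Cx , 1≤Cy) = inj₂ (suc x , suc y , x≢y ∘ Fin.suc-injective , 1≤Cx , 1≤Cy)

-- Pebbling in a weighted graph

module _ {n m : ℕ} (G : Graph n m) (W : Weights m) where

  infix 4 _⇝_
  _⇝_ : Config n → Config n → Set
  _⇝_ = Star (Step G W)

  ⇝-CanReach : ∀ {C D t} → C ⇝ D → CanReach G W D t → CanReach G W C t
  ⇝-CanReach C⇝D (E , D⇝E , 1≤Et) = E , C⇝D ◅◅ D⇝E , 1≤Et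

  step-along : ∀ {e u v} → Joins G e u v → ∀ (C : Config n) k → 1 ≤ k → k ≤ C u →
               Step G W C (move C u v (W e) k)
  step-along {e} (inj₁ eq) C k 1≤k k≤Cu = subst (λ (u , v) → Step G W C (move C u v (W e) k)) eq
    (stepFwd C e k 1≤k (subst (λ (u , _) → k ≤ C u) (sym eq) k≤Cu))
  step-along {e} (inj₂ eq) C k 1≤k k≤Cu = subst (λ (v , u) → Step G W C (move C u v (W e) k)) eq
    (stepBwd C e k 1≤k (subst (λ (_ , u) → k ≤ C u) (sym eq) k≤Cu))

  cross-half : ∀ {e u v} → W e ≡ ½ → Joins G e u v → ∀ C → 2 ≤ C u → ∃[ D ] C ⇝ D × 1 ≤ D v
  cross-half {e} {u} {v} We≡½ j C 2≤Cu =
    move C u v (W e) 2 , step-along j C 2 (s≤s z≤n) 2≤Cu ◅ ε ,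
    -- ⌊ ½ · 2 ⌋ computes to 1
    subst (1 ≤_) (sym (trans (move-target C u v (W e) 2 (joins-≢ G j ∘ sym)) (cong (λ w → C v + ⌊ w · 2 ⌋) We≡½)))
      (ℕ.m≤n+m 1 (C v))

  UnitWeight : Subset m → Set
  UnitWeight F = ∀ {e} → e ∈ F → W e ≡ 1ℚ

  module _ {F : Subset m} (unit : UnitWeight F) where

    transfer-link : ∀ {x y} → Link G F x y → ∀ C {k} → 1 ≤ k → k ≤ C x → ∃[ D ] C ⇝ D × Transfer k x y C D
    transfer-link (e , e∈F , j) C {k} 1≤k k≤Cx =
      move C _ _ (W e) k , step-along j C k 1≤k k≤Cx ◅ ε ,
      transfer-move C (W e) k (joins-≢ G j ∘ sym) (trans (cong ⌊_· k ⌋ (unit e∈F)) (⌊1·k⌋≡k k)) k≤Cx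

    transport : ∀ {x y} → Star (Link G F) x y → ∀ C {k} → 1 ≤ k → k ≤ C x → ∃[ D ] C ⇝ D × Transfer k x y C D
    transport ε             C _   _    = C , ε , transfer-refl
    transport (link ◅ walk) C 1≤k k≤Cx with transfer-link link C 1≤k k≤Cx
    ... | D , C⇝D , C→D with transport walk D 1≤k (transfer-target k≤Cx C→D)
    ...   | E , D⇝E , D→E = E , C⇝D ◅◅ D⇝E , transfer-trans C→D D→E

    module TwoPebbles (ρ σ : Fin n) (cross : ∀ C → 2 ≤ C σ → ∃[ D ] C ⇝ D × 1 ≤ D ρ)
                      (side : ∀ v → Star (Link G F) v ρ ⊎ Star (Link G F) v σ) where

      deliver : ∀ {C x t} → 1 ≤ C x → Star (Link G F) x ρ → Star (Link G F) t ρ → CanReach G W C t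
      deliver {C} 1≤Cx x→ρ t→ρ with transport (x→ρ ◅◅ reverse (Link-sym G) t→ρ) C ℕ.≤-refl 1≤Cx
      ... | D , C⇝D , C→D = D , C⇝D , transfer-target 1≤Cx C→D

      deliver-pair : ∀ {C x t} → 2 ≤ C x → Star (Link G F) x σ → Star (Link G F) t ρ → CanReach G W C t
      deliver-pair {C} 2≤Cx x→σ t→ρ with transport x→σ C (s≤s z≤n) 2≤Cx
      ... | D , C⇝D , C→D with cross D (transfer-target 2≤Cx C→D)
      ...   | E , D⇝E , 1≤Eρ = ⇝-CanReach (C⇝D ◅◅ D⇝E) (deliver 1≤Eρ ε t→ρ)

      gather : ∀ {C x y} → x ≢ y → 1 ≤ C x → 1 ≤ C y → Star (Link G F) x σ → Star (Link G F) y σ →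
               ∃[ D ] C ⇝ D × 2 ≤ D x
      gather {C} {x} x≢y 1≤Cx 1≤Cy x→σ y→σ with transport (y→σ ◅◅ reverse (Link-sym G) x→σ) C ℕ.≤-refl 1≤Cy
      ... | D , C⇝D , C→D =
        D , C⇝D , subst (2 ≤_) (sym (trans (transfer-gain (x≢y ∘ sym) C→D) (ℕ.+-comm (C x) 1))) (s≤s 1≤Cx)

      solve : ∀ C t → 2 ≤ size C → Star (Link G F) t ρ → CanReach G W C t
      solve C t 2≤size t→ρ with two-pebbles C 2≤size
      ... | inj₁ (x , 2≤Cx) with side x
      ...   | inj₁ x→ρ = deliver (ℕ.≤-trans (s≤s z≤n) 2≤Cx) x→ρ t→ρ
      ...   | inj₂ x→σ = deliver-pair 2≤Cx x→σ t→ρ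
      solve C t _ t→ρ | inj₂ (x , y , x≢y , 1≤Cx , 1≤Cy) with side x | side y
      ... | inj₁ x→ρ | _         = deliver 1≤Cx x→ρ t→ρ
      ... | inj₂ _   | inj₁ y→ρ = deliver 1≤Cy y→ρ t→ρ
      ... | inj₂ x→σ | inj₂ y→σ with gather x≢y 1≤Cx 1≤Cy x→σ y→σ
      ...   | D , C⇝D , 2≤Dx = ⇝-CanReach C⇝D (deliver-pair 2≤Dx x→σ t→ρ)

  unitEdges : Subset m
  unitEdges = tabulate (λ e → does (W e ℚ.≟ 1ℚ))

  ∈-unitEdges : ∀ {e} → W e ≡ 1ℚ → e ∈ unitEdges
  ∈-unitEdges {e} We≡1 = lookup⇒[]= e unitEdges (trans (lookup∘tabulate _ e) (dec-true (W e ℚ.≟ 1ℚ) We≡1))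

  indicator-unitEdges-≤ : (∀ e → 0ℚ ℚ.≤ W e) → ∀ e → indicator unitEdges e ℚ.≤ W e
  indicator-unitEdges-≤ 0≤W e rewrite lookup∘tabulate (λ e → does (W e ℚ.≟ 1ℚ)) e with W e ℚ.≟ 1ℚ
  ... | yes We≡1 = ℚ.≤-reflexive (sym We≡1)
  ... | no  _    = 0≤W e

  AtMostOnePebble : Fin n → Config n → Set
  AtMostOnePebble r D = ∃[ p ] Star (Link G unitEdges) r p × (∀ x → D x ≤ δ p 1 x)

  module _ (valid : ∀ e → (0ℚ ℚ.≤ W e) × (W e ℚ.≤ 1ℚ)) (r : Fin n) where

    at-most-one-move : ∀ {e u v} → Joins G e u v → ∀ C k → 1 ≤ k → k ≤ C u →
                       AtMostOnePebble r C → AtMostOnePebble r (move C u v (W e) k)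
    at-most-one-move {e} {u} {v} j C k 1≤k k≤Cu (p , r→p , C≤δp)
      with δ-support {x = p} {k = 1} {v = u} (ℕ.≤-trans 1≤k (ℕ.≤-trans k≤Cu (C≤δp u)))
    -- the move takes the lone pebble: u = p and k = 1
    ... | refl with ℕ.≤-antisym (ℕ.≤-trans k≤Cu (ℕ.≤-trans (C≤δp u) (δ-≤ u 1 u))) 1≤k
    ...   | refl with ℚ.<-cmp (W e) 1ℚ
    ...     | tri< We<1 _ _ = u , r→p , λ x → ℕ.≤-trans (E≤C x) (C≤δp x)
      where
      E≤C : ∀ x → move C u v (W e) 1 x ≤ C x
      E≤C = move-≤ C (W e) 1 (joins-≢ G j ∘ sym) (⌊w·1⌋≡0 (proj₁ (valid e)) We<1)
    ...     | tri> _ _ We>1 = contradiction (ℚ.<-≤-trans We>1 (proj₂ (valid e))) (ℚ.<-irrefl refl)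
    ...     | tri≈ _ We≡1 _ = v , r→p ◅◅ ((e , ∈-unitEdges We≡1 , j) ◅ ε) , E≤δv
      where
      E : Config n
      E = move C u v (W e) 1
      C→E : Transfer 1 u v C E
      C→E = transfer-move C (W e) 1 (joins-≢ G j ∘ sym) (trans (cong ⌊_· 1 ⌋ We≡1) (⌊1·k⌋≡k 1)) k≤Cu
      E≤δv : ∀ x → E x ≤ δ v 1 x
      E≤δv x = ℕ.+-cancelʳ-≤ (δ u 1 x) (E x) (δ v 1 x) (begin
        E x + δ u 1 x      ≡⟨ C→E x ⟩
        C x + δ v 1 x      ≤⟨ ℕ.+-monoˡ-≤ (δ v 1 x) (C≤δp x) ⟩
        δ u 1 x + δ v 1 x  ≡⟨ ℕ.+-comm (δ u 1 x) (δ v 1 x) ⟩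
        δ v 1 x + δ u 1 x  ∎)
        where open ℕ.≤-Reasoning

    at-most-one-⇝ : ∀ {C D} → C ⇝ D → AtMostOnePebble r C → AtMostOnePebble r D
    at-most-one-⇝ ε                                 C₁ = C₁
    at-most-one-⇝ (stepFwd C e k 1≤k k≤Cu ◅ C′⇝D) C₁ =
      at-most-one-⇝ C′⇝D (at-most-one-move (inj₁ refl) C k 1≤k k≤Cu C₁)
    at-most-one-⇝ (stepBwd C e k 1≤k k≤Cu ◅ C′⇝D) C₁ =
      at-most-one-⇝ C′⇝D (at-most-one-move (inj₂ refl) C k 1≤k k≤Cu C₁)

    solvable₁⇒unitEdges-connect : Solvable G W 1 → ∀ t → Star (Link G unitEdges) r t
    solvable₁⇒unitEdges-connect solvable t with solvable (δ r 1) (size-δ r 1) t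
    ... | D , δr⇝D , 1≤Dt with at-most-one-⇝ δr⇝D (r , ε , λ _ → ℕ.≤-refl)
    ...   | p , r→p , D≤δp =
      subst (Star (Link G unitEdges) r) (sym (δ-support {x = p} {k = 1} {v = t} (ℕ.≤-trans 1≤Dt (D≤δp t)))) r→p

-- The two bounds

not-solvable₁ : ∀ {n m} (G : Graph (ℕ.suc n) m) → m + 3 ≡ 2 * ℕ.suc n →
                ∀ W → ValidHalf m W → ¬ Solvable G W 1
not-solvable₁ {n} {m} G m+3≡2n W (valid , ΣW≡m/2) solvable = ℕ.<-irrefl refl (begin-strict
  2 * ℕ.suc n            ≤⟨ ℕ.*-monoʳ-≤ 2 n≤∣U∣+1 ⟩
  2 * (∣ U ∣ + 1)        ≡⟨ ℕ.*-distribˡ-+ 2 ∣ U ∣ 1 ⟩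
  2 * ∣ U ∣ + 2          ≤⟨ ℕ.+-monoˡ-≤ 2 2∣U∣≤m ⟩
  m + 2                 <⟨ ℕ.+-monoʳ-< m (ℕ.n<1+n 2) ⟩
  m + 3                 ≡⟨ m+3≡2n ⟩
  2 * ℕ.suc n            ∎)
  where
  open ℕ.≤-Reasoning
  U : Subset m
  U = unitEdges G W

  n≤∣U∣+1 : ℕ.suc n ≤ ∣ U ∣ + 1
  n≤∣U∣+1 with spanningForest G U ⁅ zero ⁆
                 (λ v → zero , x∈⁅x⁆ zero , solvable₁⇒unitEdges-connect G W valid zero solvable v)
  ... | F , F⊆U , ∣F∣+1≡n , _ =
    subst (_≤ ∣ U ∣ + 1) (trans (cong (∣ F ∣ +_) (sym (∣⁅x⁆∣≡1 {n = ℕ.suc n} zero))) ∣F∣+1≡n)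
      (ℕ.+-monoˡ-≤ 1 (p⊆q⇒∣p∣≤∣q∣ F⊆U))

  2∣U∣≤m : 2 * ∣ U ∣ ≤ m
  2∣U∣≤m = ιc≤m/2⇒2c≤m ∣ U ∣ m (subst₂ ℚ._≤_ (sumℚ-indicator U) ΣW≡m/2
    (sumℚ-mono-≤ (indicator-unitEdges-≤ G W (proj₁ ∘ valid))))

halfThenIndicator : ∀ {m} → Subset m → Weights (ℕ.suc m)
halfThenIndicator T zero    = ½
halfThenIndicator T (suc e) = indicator T e

module _ {n m : ℕ} (G : Graph n (ℕ.suc m)) (connected : Connected G) where

  private
    a c : Fin n
    a = proj₁ (edge G zero)
    c = proj₂ (edge G zero)

    ends : Subset n
    ends = ⁅ a ⁆ ∪ ⁅ c ⁆

    a∈ends : a ∈ ends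
    a∈ends = x∈p∪q⁺ (inj₁ (x∈⁅x⁆ a))

    c∈ends : c ∈ ends
    c∈ends = x∈p∪q⁺ (inj₂ (x∈⁅x⁆ c))

    ∣ends∣≡2 : ∣ ends ∣ ≡ 2
    ∣ends∣≡2 = trans (x∉p⇒∣⁅x⁆∪p∣≡1+∣p∣ a ⁅ c ⁆ (x≢y⇒x∉⁅y⁆ (joins-≢ G (inj₁ refl)))) (cong ℕ.suc (∣⁅x⁆∣≡1 c))

    otherEdges : Subset (ℕ.suc m)
    otherEdges = outside ∷ ⊤

    reach-ends : ∀ {x y} → ReachableFrom G otherEdges ends x → Star (Adj G) x y →
                 ReachableFrom G otherEdges ends y
    reach-ends x∈R ε = x∈R
    reach-ends _ (fwd zero ◅ walk) = reach-ends (c , c∈ends , ε) walk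
    reach-ends _ (bwd zero ◅ walk) = reach-ends (a , a∈ends , ε) walk
    reach-ends (s , s∈ends , s→x) (fwd (suc e) ◅ walk) =
      reach-ends (s , s∈ends , s→x ◅◅ ((suc e , there ∈⊤ , inj₁ refl) ◅ ε)) walk
    reach-ends (s , s∈ends , s→x) (bwd (suc e) ◅ walk) =
      reach-ends (s , s∈ends , s→x ◅◅ ((suc e , there ∈⊤ , inj₂ refl) ◅ ε)) walk

  halfWeight-solvable₂ : ℕ.suc m + 3 ≡ 2 * n →
                         Σ (Weights (ℕ.suc m)) λ W → ValidHalf (ℕ.suc m) W × Solvable G W 2
  halfWeight-solvable₂ m+3≡2n
    with spanningForest G otherEdges ends (λ v → reach-ends (a , a∈ends , ε) (connected a v))
  ... | inside ∷ T , F⊆otherEdges , _ , _ = contradiction (F⊆otherEdges here) λ ()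
  ... | outside ∷ T , _ , ∣T∣+∣ends∣≡n , spans = W , (valid , ΣW≡m/2) , solvable
    where
    W : Weights (ℕ.suc m)
    W = halfThenIndicator T

    valid : ∀ e → (0ℚ ℚ.≤ W e) × (W e ℚ.≤ 1ℚ)
    valid zero    = ℚ.*≤* (ℤ.+≤+ z≤n) , ℚ.*≤* (ℤ.+≤+ (s≤s z≤n))
    valid (suc e) = indicator-bounds T e

    m≡2∣T∣ : m ≡ 2 * ∣ T ∣
    m≡2∣T∣ = ℕ.+-cancelʳ-≡ 4 m (2 * ∣ T ∣) (begin
      m + 4              ≡⟨ ℕ.+-suc m 3 ⟩
      ℕ.suc m + 3        ≡⟨ m+3≡2n ⟩
      2 * n              ≡⟨ cong (2 *_) (trans (cong (∣ T ∣ +_) (sym ∣ends∣≡2)) ∣T∣+∣ends∣≡n) ⟨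
      2 * (∣ T ∣ + 2)    ≡⟨ ℕ.*-distribˡ-+ 2 ∣ T ∣ 2 ⟩
      2 * ∣ T ∣ + 4      ∎)
      where open ≡-Reasoning

    ΣW≡m/2 : sumℚ W ≡ ℤ.+ ℕ.suc m ℚ./ 2
    ΣW≡m/2 = begin
      ½ ℚ.+ sumℚ (indicator T)      ≡⟨ cong (½ ℚ.+_) (sumℚ-indicator T) ⟩
      ½ ℚ.+ ι ∣ T ∣                 ≡⟨ ½+ιt≡[1+2t]/2 ∣ T ∣ ⟩
      ℤ.+ ℕ.suc (2 * ∣ T ∣) ℚ./ 2   ≡⟨ cong (λ k → ℤ.+ ℕ.suc k ℚ./ 2) m≡2∣T∣ ⟨
      ℤ.+ ℕ.suc m ℚ./ 2             ∎
      where open ≡-Reasoning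

    unit : UnitWeight G W (outside ∷ T)
    unit (there e∈T) = cong (if_then 1ℚ else 0ℚ) ([]=⇒lookup e∈T)

    side : ∀ v → Star (Link G (outside ∷ T)) v a ⊎ Star (Link G (outside ∷ T)) v c
    side v with spans v
    ... | s , s∈ends , s→v with x∈p∪q⁻ ⁅ a ⁆ ⁅ c ⁆ s∈ends
    ...   | inj₁ s∈⁅a⁆ = inj₁ (subst (Star _ v) (x∈⁅y⁆⇒x≡y a s∈⁅a⁆) (reverse (Link-sym G) s→v))
    ...   | inj₂ s∈⁅c⁆ = inj₂ (subst (Star _ v) (x∈⁅y⁆⇒x≡y c s∈⁅c⁆) (reverse (Link-sym G) s→v))

    solvable : Solvable G W 2
    solvable C size≡2 t with side t
    ... | inj₁ t→a = TwoPebbles.solve G W unit a c (cross-half G W refl (inj₂ refl)) side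
                       C t (ℕ.≤-reflexive (sym size≡2)) t→a
    ... | inj₂ t→c = TwoPebbles.solve G W unit c a (cross-half G W refl (inj₁ refl)) (Sum.swap ∘ side)
                       C t (ℕ.≤-reflexive (sym size≡2)) t→c

corollary4 : (n m : ℕ) (G : Graph n m) → Connected G → m + 3 ≡ 2 * n →
    WpEquals G 2
corollary4 ℕ.zero m G _ m+3≡0 = contradiction (trans (ℕ.+-comm 3 m) m+3≡0) λ ()
corollary4 (ℕ.suc ℕ.zero) m G _ m+3≡2 = contradiction (trans (ℕ.+-comm 3 m) m+3≡2) λ ()
corollary4 (ℕ.suc (ℕ.suc n)) ℕ.zero G _ 3≡2n = contradiction (trans 3≡2n (ℕ.*-distribˡ-+ 2 2 n)) λ ()
corollary4 (ℕ.suc n) (ℕ.suc m) G connected m+3≡2n =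
  s≤s z≤n , halfWeight-solvable₂ G connected m+3≡2n , fewer-pebbles
  where
  fewer-pebbles : ∀ q → 1 ≤ q → q < 2 → ∀ W → ValidHalf (ℕ.suc m) W → ¬ Solvable G W q
  fewer-pebbles 1 _ _ = not-solvable₁ G m+3≡2n
  fewer-pebbles (ℕ.suc (ℕ.suc _)) _ (s≤s (s≤s ()))
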